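{- Let $k$ be a positive integer, $H$ a graph, $v$ a vertex of $H$, and $H'=H-v$ with $\chi(H')\leq k$. If $k>d_H(v)+\min\{d_H(v),g_k(H')\}$, then $g_k(H)\leq g_k(H')$.
   Context: For a graph $H$ and $k\geq\chi(H)$, a proper $k$-coloring is a map $V(H)\to[k]$ giving adjacent vertices different colors. For a positive integer $j$, $G^j_k(H)$ has the proper $k$-colorings of $H$ as vertices, two distinct colorings adjacent if $H$ contains a connected subgraph on at most $j$ vertices containing all vertices where they differ; $g_k(H)$ is the least $j\geq1$ with $G^j_k(H)$ connected. -}

module Defs where

open import Data.Nat using (ℕ; zero; suc; _≤_; _<_)
open import Data.Bool using (Bool; true; false)
open import Data.Fin using (Fin; punchIn)
open import Data.Fin.Subset using (Subset; _∈_; ∣_∣)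
open import Data.Vec using (tabulate)
open import Data.Product using (Σ; ∃; _×_; proj₁)
open import Relation.Binary.PropositionalEquality using (_≡_; _≢_)
open import Relation.Nullary using (¬_)

record Graph (n : ℕ) : Set where
  field
    adj    : Fin n → Fin n → Bool
    sym    : ∀ x y → adj x y ≡ adj y x
    irrefl : ∀ x → adj x x ≡ false
open Graph public

Adj : ∀ {n} → Graph n → Fin n → Fin n → Set
Adj H x y = adj H x y ≡ true

degree : ∀ {n} → Graph n → Fin n → ℕ
degree H v = ∣ tabulate (adj H v) ∣

deleteVertex : ∀ {m} → Graph (suc m) → Fin (suc m) → Graph m
deleteVertex H v = record
  { adj    = λ x y → adj H (punchIn v x) (punchIn v y)
  ; sym    = λ x y → sym H (punchIn v x) (punchIn v y)
  ; irrefl = λ x → irrefl H (punchIn v x)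
  }

IsProper : ∀ {n} (H : Graph n) (k : ℕ) → (Fin n → Fin k) → Set
IsProper H k c = ∀ x y → Adj H x y → c x ≢ c y

Colouring : ∀ {n} (H : Graph n) (k : ℕ) → Set
Colouring {n} H k = Σ (Fin n → Fin k) (IsProper H k)

ChromaticAtMost : ∀ {n} → Graph n → ℕ → Set
ChromaticAtMost H k = Colouring H k

data WalkIn {n} (H : Graph n) (S : Subset n) : Fin n → Fin n → Set where
  here : ∀ {x} → x ∈ S → WalkIn H S x x
  step : ∀ {x y z} → x ∈ S → Adj H x y → WalkIn H S y z → WalkIn H S x z

ConnectedIn : ∀ {n} → Graph n → Subset n → Set
ConnectedIn {n} H S = ∀ (x y : Fin n) → x ∈ S → y ∈ S → WalkIn H S x y

AdjG : ∀ {n} (H : Graph n) (k j : ℕ) → Colouring H k → Colouring H k → Set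
AdjG {n} H k j α β =
  (∃ λ x → proj₁ α x ≢ proj₁ β x) ×
  (∃ λ (S : Subset n) → ∣ S ∣ ≤ j × ConnectedIn H S ×
     (∀ x → proj₁ α x ≢ proj₁ β x → x ∈ S))

data ReachG {n} (H : Graph n) (k j : ℕ) : Colouring H k → Colouring H k → Set where
  stay : ∀ {α β} → (∀ x → proj₁ α x ≡ proj₁ β x) → ReachG H k j α β
  move : ∀ {α β γ} → AdjG H k j α β → ReachG H k j β γ → ReachG H k j α γ

ConnectedG : ∀ {n} (H : Graph n) (k j : ℕ) → Set
ConnectedG H k j = ∀ (α β : Colouring H k) → ReachG H k j α β

IsGk : ∀ {n} (H : Graph n) (k g : ℕ) → Set
IsGk H k g = 1 ≤ g × ConnectedG H k g × (∀ j → 1 ≤ j → j < g → ¬ ConnectedG H k j)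

module Submission where

-- Let H′ = H - v and j = g_k(H′).  It suffices to show that
-- G^j_k(H) is connected, since g_k(H) is the least such j.  Given proper
-- colourings γ, δ of H, join their restrictions to H′ by a path in
-- G^j_k(H′) and lift it step by step.  Suppose γ restricts to α′ and
-- α′ ~ β′ in G^j_k(H′), the difference set lying in a connected S with
-- |S| ≤ j.  Forbid for v the colours γ uses on N(v) and the colours β′
-- uses on N(v) ∩ S: at most d(v) + min(d(v), j) < k colours, so a free
-- colour c remains.  Recolouring v to c is one step (a single vertex is a
-- connected set), and then changing α′ to β′ on S, keeping c at v, is a
-- second step; the result restricts to β′.  Finally, colourings with the
-- same restriction differ only at v and are again joined by one step.

open import Defs hiding (sym)
open import Data.Nat using (ℕ; suc; _≤_; _<_; _+_; _⊓_; _≤?_)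
open import Data.Fin using (Fin; zero; suc; punchIn; punchOut; _≟_)

import Data.Nat.Properties as ℕ
open import Data.Fin.Properties using (any?; injective⇒≤; punchIn-punchOut)
open import Data.Fin.Subset using (Subset; _∈_; inside; outside; ⁅_⁆; _∩_; ∣_∣)
open import Data.Fin.Subset.Properties
  using (x∈⁅x⁆; x∈⁅y⁆⇒x≡y; ∣⁅x⁆∣≡1; p⊆q⇒∣p∣≤∣q∣; p∩q⊆p; p∩q⊆q; x∈p∩q⁺)
open import Data.Vec using ([]; _∷_; here; there; insertAt; tabulate)
open import Data.Vec.Properties using ([]=⇒lookup; lookup⇒[]=; insertAt-lookup; insertAt-punchIn; lookup∘tabulate)
import Data.Vec.Functional as Fun
import Data.Vec.Functional.Properties as Fun
open import Data.List using (List; length; lookup; _++_) renaming ([] to []ˡ; _∷_ to _∷ˡ_)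
open import Data.List.Properties using (length-++)
open import Data.List.Membership.Propositional using () renaming (_∈_ to _∈ˡ_; _∉_ to _∉ˡ_)
open import Data.List.Membership.Propositional.Properties using (∈-++⁺ˡ; ∈-++⁺ʳ)
open import Data.List.Membership.DecPropositional using () renaming (_∈?_ to member?)
open import Data.List.Relation.Unary.Any using (here; there; index)
open import Data.List.Relation.Unary.Any.Properties using (lookup-index)
open import Data.Product using (Σ; ∃; _×_; _,_; proj₁; proj₂)
open import Data.Empty using (⊥; ⊥-elim)
open import Data.Bool using (true; false)
open import Relation.Nullary using (¬?; yes; no)
open import Relation.Binary.PropositionalEquality
  using (_≡_; _≢_; refl; sym; trans; cong; subst; subst₂)

-- Pigeonhole: fewer than k forbidden colours leave a free colour in Fin k.
-- If every colour occurred, its position in the list would be an injection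
-- Fin k → Fin (length xs).
freeColour : ∀ {k} (xs : List (Fin k)) → length xs < k → ∃ λ c → c ∉ˡ xs
freeColour xs short with any? (λ c → ¬? (member? _≟_ c xs))
... | yes free = free
... | no none = ⊥-elim (ℕ.<⇒≱ short (injective⇒≤ position-injective))
  where
  occurs : ∀ c → c ∈ˡ xs
  occurs c with member? _≟_ c xs
  ... | yes c∈xs = c∈xs
  ... | no  c∉xs = ⊥-elim (none (c , c∉xs))

  position-injective : ∀ {c d} → index (occurs c) ≡ index (occurs d) → c ≡ d
  position-injective {c} {d} same =
    trans (lookup-index (occurs c)) (trans (cong (lookup xs) same) (sym (lookup-index (occurs d))))

valuesOn : ∀ {n} {A : Set} → Subset n → (Fin n → A) → List A
valuesOn []            f = []ˡ
valuesOn (inside  ∷ p) f = f zero ∷ˡ valuesOn p (λ i → f (suc i))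
valuesOn (outside ∷ p) f = valuesOn p (λ i → f (suc i))

length-valuesOn : ∀ {n} {A : Set} (p : Subset n) (f : Fin n → A) → length (valuesOn p f) ≡ ∣ p ∣
length-valuesOn []            f = refl
length-valuesOn (inside  ∷ p) f = cong suc (length-valuesOn p _)
length-valuesOn (outside ∷ p) f = length-valuesOn p _

∈-valuesOn : ∀ {n} {A : Set} (p : Subset n) (f : Fin n → A) {x} → x ∈ p → f x ∈ˡ valuesOn p f
∈-valuesOn (inside  ∷ p) f here        = here refl
∈-valuesOn (inside  ∷ p) f (there x∈p) = there (∈-valuesOn p _ x∈p)
∈-valuesOn (outside ∷ p) f (there x∈p) = ∈-valuesOn p _ x∈p

module Paths {n} (H : Graph n) (k j : ℕ) where

  Col : Set
  Col = Colouring H k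

  reach-respˡ : ∀ {γ δ ε : Col} → (∀ x → proj₁ γ x ≡ proj₁ δ x) → ReachG H k j δ ε → ReachG H k j γ ε
  reach-respˡ γ≗δ (stay δ≗ε) = stay (λ x → trans (γ≗δ x) (δ≗ε x))
  reach-respˡ γ≗δ (move ((x , differ) , S , small , connected , covers) rest) =
    move ( (x , λ e → differ (trans (sym (γ≗δ x)) e))
         , S , small , connected , λ y d → covers y (λ e → d (trans (γ≗δ y) e)) )
         rest

  reach-trans : ∀ {γ δ ε : Col} → ReachG H k j γ δ → ReachG H k j δ ε → ReachG H k j γ ε
  reach-trans (stay γ≗δ)    δ⇝ε = reach-respˡ γ≗δ δ⇝ε
  reach-trans (move γ~β β⇝δ) δ⇝ε = move γ~β (reach-trans β⇝δ δ⇝ε)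

  reach-adj : ∀ {γ δ : Col} → AdjG H k j γ δ → ReachG H k j γ δ
  reach-adj {δ = δ} γ~δ = move {β = δ} γ~δ (stay (λ _ → refl))

  singleton-connected : (w : Fin n) → ConnectedIn H ⁅ w ⁆
  singleton-connected w x y x∈ y∈ =
    subst₂ (WalkIn H ⁅ w ⁆) (sym (x∈⁅y⁆⇒x≡y w x∈)) (sym (x∈⁅y⁆⇒x≡y w y∈)) (here (x∈⁅x⁆ w))

  reach-recolour : 1 ≤ j → (w : Fin n) (γ δ : Col) →
                   (∀ x → x ≢ w → proj₁ γ x ≡ proj₁ δ x) → ReachG H k j γ δ
  reach-recolour 1≤j w γ δ agree with proj₁ γ w ≟ proj₁ δ w
  ... | yes same = stay everywhere
    where
    everywhere : ∀ x → proj₁ γ x ≡ proj₁ δ x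
    everywhere x with x ≟ w
    ... | yes refl = same
    ... | no  x≢w  = agree x x≢w
  ... | no differ = reach-adj ((w , differ) , ⁅ w ⁆ , small , singleton-connected w , covers)
    where
    small : ∣ ⁅ w ⁆ ∣ ≤ j
    small = subst (_≤ j) (sym (∣⁅x⁆∣≡1 w)) 1≤j

    covers : ∀ x → proj₁ γ x ≢ proj₁ δ x → x ∈ ⁅ w ⁆
    covers x d with x ≟ w
    ... | yes refl = x∈⁅x⁆ w
    ... | no  x≢w  = ⊥-elim (d (agree x x≢w))

module VertexDeletion {m} (H : Graph (suc m)) (v : Fin (suc m)) where

  H′ : Graph m
  H′ = deleteVertex H v

  data View : Fin (suc m) → Set where
    deleted : View v
    kept    : ∀ u → View (punchIn v u)

  view : ∀ w → View w
  view w with v ≟ w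
  ... | yes refl = deleted
  ... | no  v≢w  = subst View (punchIn-punchOut v≢w) (kept (punchOut v≢w))

  Restricts : ∀ {k} → Colouring H k → Colouring H′ k → Set
  Restricts γ α′ = ∀ u → proj₁ γ (punchIn v u) ≡ proj₁ α′ u

  restrict : ∀ {k} → Colouring H k → Colouring H′ k
  restrict γ = (λ u → proj₁ γ (punchIn v u)) , (λ x y x~y → proj₂ γ (punchIn v x) (punchIn v y) x~y)

  agree-off-v : ∀ {k} (γ δ : Colouring H k) (α′ : Colouring H′ k) →
                Restricts γ α′ → Restricts δ α′ → ∀ x → x ≢ v → proj₁ γ x ≡ proj₁ δ x
  agree-off-v γ δ α′ γ↾ δ↾ x x≢v with view x
  ... | deleted = ⊥-elim (x≢v refl)
  ... | kept u  = trans (γ↾ u) (sym (δ↾ u))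

  extend : ∀ {k} → Colouring H′ k → Fin k → Fin (suc m) → Fin k
  extend α′ a = Fun.insertAt (proj₁ α′) v a

  extend-v : ∀ {k} (α′ : Colouring H′ k) a → extend α′ a v ≡ a
  extend-v α′ a = Fun.insertAt-lookup (proj₁ α′) v a

  extend-kept : ∀ {k} (α′ : Colouring H′ k) a u → extend α′ a (punchIn v u) ≡ proj₁ α′ u
  extend-kept α′ a u = Fun.insertAt-punchIn (proj₁ α′) v a u

  extend-proper : ∀ {k} (α′ : Colouring H′ k) (a : Fin k) →
                  (∀ u → Adj H v (punchIn v u) → a ≢ proj₁ α′ u) → IsProper H k (extend α′ a)
  extend-proper α′ a avoids x y x~y with view x | view y
  ... | deleted | deleted = λ _ → ⊥-elim (no-loop (trans (sym (irrefl H v)) x~y))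
    where
    no-loop : false ≢ true
    no-loop ()
  ... | deleted | kept u  = λ e → avoids u x~y
                                    (trans (sym (extend-v α′ a)) (trans e (extend-kept α′ a u)))
  ... | kept u  | deleted = λ e → avoids u (trans (Graph.sym H v (punchIn v u)) x~y)
                                    (trans (sym (extend-v α′ a)) (trans (sym e) (extend-kept α′ a u)))
  ... | kept u  | kept u′ = λ e → proj₂ α′ u u′ x~y
                                    (trans (sym (extend-kept α′ a u)) (trans e (extend-kept α′ a u′)))

  extension : ∀ {k} (α′ : Colouring H′ k) (a : Fin k) →
              (∀ u → Adj H v (punchIn v u) → a ≢ proj₁ α′ u) → Colouring H k
  extension α′ a avoids = extend α′ a , extend-proper α′ a avoids

  extension-restricts : ∀ {k} (α′ : Colouring H′ k) a avoids → Restricts (extension α′ a avoids) α′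
  extension-restricts α′ a _ = extend-kept α′ a

  lift : Subset m → Subset (suc m)
  lift S = insertAt S v outside

  ∈-lift : ∀ {S u} → u ∈ S → punchIn v u ∈ lift S
  ∈-lift {S} {u} u∈S = lookup⇒[]= _ (lift S) (trans (insertAt-punchIn S v outside u) ([]=⇒lookup u∈S))

  ∈-lift⁻ : ∀ {S u} → punchIn v u ∈ lift S → u ∈ S
  ∈-lift⁻ {S} {u} u∈S = lookup⇒[]= u S (trans (sym (insertAt-punchIn S v outside u)) ([]=⇒lookup u∈S))

  v∉lift : ∀ {S} → v ∈ lift S → ⊥
  v∉lift {S} v∈S with trans (sym (insertAt-lookup S v outside)) ([]=⇒lookup v∈S)
  ... | ()

  ∣lift∣ : ∀ {n} (S : Subset n) (w : Fin (suc n)) → ∣ insertAt S w outside ∣ ≡ ∣ S ∣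
  ∣lift∣ S             zero    = refl
  ∣lift∣ (inside  ∷ S) (suc w) = cong suc (∣lift∣ S w)
  ∣lift∣ (outside ∷ S) (suc w) = ∣lift∣ S w

  liftWalk : ∀ {S x y} → WalkIn H′ S x y → WalkIn H (lift S) (punchIn v x) (punchIn v y)
  liftWalk (here x∈S)           = here (∈-lift x∈S)
  liftWalk (step x∈S x~y walk) = step (∈-lift x∈S) x~y (liftWalk walk)

  lift-connected : ∀ {S} → ConnectedIn H′ S → ConnectedIn H (lift S)
  lift-connected connected x y x∈ y∈ with view x | view y
  ... | deleted | _       = ⊥-elim (v∉lift x∈)
  ... | kept _  | deleted = ⊥-elim (v∉lift y∈)
  ... | kept u  | kept u′ = liftWalk (connected u u′ (∈-lift⁻ x∈) (∈-lift⁻ y∈))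

  -- An edge of G^j_k(H′) lifts to an edge of G^j_k(H) between any two
  -- extensions that agree at v: the same difference set works, lifted.
  lift-adj : ∀ {k j} {α′ β′ : Colouring H′ k} (γ δ : Colouring H k) →
             Restricts γ α′ → Restricts δ β′ → proj₁ γ v ≡ proj₁ δ v →
             AdjG H′ k j α′ β′ → AdjG H k j γ δ
  lift-adj {j = j} γ δ γ↾ δ↾ same-at-v ((u , differ) , S , small , connected , covers) =
    ( (punchIn v u , λ e → differ (trans (sym (γ↾ u)) (trans e (δ↾ u))))
    , lift S , subst (_≤ j) (sym (∣lift∣ S v)) small , lift-connected connected , lifted-covers )
    where
    lifted-covers : ∀ x → proj₁ γ x ≢ proj₁ δ x → x ∈ lift S
    lifted-covers x d with view x
    ... | deleted = ⊥-elim (d same-at-v)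
    ... | kept u′ = ∈-lift (covers u′ (λ e → d (trans (γ↾ u′) (trans e (sym (δ↾ u′))))))

  neighbours : Subset (suc m)
  neighbours = tabulate (adj H v)

  ∈-neighbours : ∀ {w} → Adj H v w → w ∈ neighbours
  ∈-neighbours {w} v~w = lookup⇒[]= w neighbours (trans (lookup∘tabulate (adj H v) w) v~w)

  forbidden-count : ∀ {k j} (f g : Fin (suc m) → Fin k) (S : Subset m) → ∣ S ∣ ≤ j →
                    length (valuesOn neighbours f ++ valuesOn (neighbours ∩ lift S) g)
                      ≤ degree H v + (degree H v ⊓ j)
  forbidden-count {j = j} f g S small
    rewrite length-++ (valuesOn neighbours f) {valuesOn (neighbours ∩ lift S) g}
          | length-valuesOn neighbours f | length-valuesOn (neighbours ∩ lift S) g =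
    ℕ.+-monoʳ-≤ (degree H v) (ℕ.⊓-glb (p⊆q⇒∣p∣≤∣q∣ (p∩q⊆p neighbours (lift S))) within-lift)
    where
    within-lift : ∣ neighbours ∩ lift S ∣ ≤ j
    within-lift = ℕ.≤-trans (p⊆q⇒∣p∣≤∣q∣ (p∩q⊆q neighbours (lift S)))
                            (subst (_≤ j) (sym (∣lift∣ S v)) small)

module Lifting {m} (H : Graph (suc m)) (v : Fin (suc m)) (k j : ℕ)
               (1≤j : 1 ≤ j) (few : degree H v + (degree H v ⊓ j) < k) where
  open VertexDeletion H v
  open Paths H k j

  -- One edge α′ ~ β′ of G^j_k(H′), starting above α′, is followed in
  -- G^j_k(H) by recolouring v to a free colour c and then changing α′ to β′.
  lift-step : (γ : Col) {α′ β′ : Colouring H′ k} → Restricts γ α′ → AdjG H′ k j α′ β′ →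
              Σ Col λ δ → Restricts δ β′ × ReachG H k j γ δ
  lift-step γ {α′} {β′} γ↾ α′~β′@(_ , S , small , _ , covers) =
    δ , extension-restricts β′ c avoids-β′ , reach-trans recolour (reach-adj change)
    where
    -- γ's colours on N(v), and β′'s colours on N(v) ∩ S (v ∉ lift S, so
    -- the colour used to extend β′ to v is irrelevant).
    nearγ nearβ′ forbidden : List (Fin k)
    nearγ     = valuesOn neighbours (proj₁ γ)
    nearβ′    = valuesOn (neighbours ∩ lift S) (extend β′ (proj₁ γ v))
    forbidden = nearγ ++ nearβ′

    free : ∃ λ c → c ∉ˡ forbidden
    free = freeColour forbidden
             (ℕ.≤-<-trans (forbidden-count (proj₁ γ) (extend β′ (proj₁ γ v)) S small) few)

    c : Fin k
    c = proj₁ free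

    -- c avoids α′ on N(v), as these are γ's colours there …
    avoids-α′ : ∀ u → Adj H v (punchIn v u) → c ≢ proj₁ α′ u
    avoids-α′ u v~u c≡ = proj₂ free (∈-++⁺ˡ
      (subst (_∈ˡ nearγ) (trans (γ↾ u) (sym c≡)) (∈-valuesOn neighbours (proj₁ γ) (∈-neighbours v~u))))

    -- … and β′ on N(v): where β′ differs from α′ the vertex lies in S.
    avoids-β′ : ∀ u → Adj H v (punchIn v u) → c ≢ proj₁ β′ u
    avoids-β′ u v~u c≡ with proj₁ α′ u ≟ proj₁ β′ u
    ... | yes same = avoids-α′ u v~u (trans c≡ (sym same))
    ... | no  diff = proj₂ free (∈-++⁺ʳ nearγ
      (subst (_∈ˡ nearβ′) (trans (extend-kept β′ _ u) (sym c≡))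
        (∈-valuesOn (neighbours ∩ lift S) _ (x∈p∩q⁺ (∈-neighbours v~u , ∈-lift (covers u diff))))))

    γ′ δ : Col
    γ′ = extension α′ c avoids-α′
    δ  = extension β′ c avoids-β′

    recolour : ReachG H k j γ γ′
    recolour = reach-recolour 1≤j v γ γ′ (agree-off-v γ γ′ α′ γ↾ (extension-restricts α′ c avoids-α′))

    change : AdjG H k j γ′ δ
    change = lift-adj {j = j} {α′} {β′} γ′ δ
               (extension-restricts α′ c avoids-α′) (extension-restricts β′ c avoids-β′)
               (trans (extend-v α′ c) (sym (extend-v β′ c))) α′~β′

  lift-path : ∀ {α′ β′} → ReachG H′ k j α′ β′ →
              (γ δ : Col) → Restricts γ α′ → Restricts δ β′ → ReachG H k j γ δ
  lift-path {α′} (stay α′≗β′) γ δ γ↾ δ↾ =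
    reach-recolour 1≤j v γ δ (agree-off-v γ δ α′ γ↾ (λ u → trans (δ↾ u) (sym (α′≗β′ u))))
  lift-path (move {α′} {β′} α′~β′ rest) γ δ γ↾ δ↾ with lift-step γ {α′} {β′} γ↾ α′~β′
  ... | γ′ , γ′↾ , γ⇝γ′ = reach-trans γ⇝γ′ (lift-path rest γ′ δ γ′↾ δ↾)

  connectedG-lift : ConnectedG H′ k j → ConnectedG H k j
  connectedG-lift connected γ δ =
    lift-path (connected (restrict γ) (restrict δ)) γ δ (λ _ → refl) (λ _ → refl)

mainTheorem17 : (k : ℕ) → 1 ≤ k → ∀ {m} (H : Graph (suc m)) (v : Fin (suc m)) →
    ChromaticAtMost (deleteVertex H v) k →
    (g g′ : ℕ) → IsGk H k g → IsGk (deleteVertex H v) k g′ →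
    degree H v + (degree H v ⊓ g′) < k →
    g ≤ g′
mainTheorem17 k _ H v _ g g′ (_ , _ , g-least) (1≤g′ , connected′ , _) few with g ≤? g′
... | yes g≤g′ = g≤g′
... | no  g≰g′ = ⊥-elim (g-least g′ 1≤g′ (ℕ.≰⇒> g≰g′) (Lifting.connectedG-lift H v k g′ 1≤g′ few connected′))
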